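{- ($\mathsf{SIE}_1$) If $\alpha$ and $\beta$ are ordinals, then exactly one of $\alpha\in\beta$, $\alpha=\beta$, $\beta\in\alpha$ holds.
   Context: An ordinal is a transitive set all of whose elements are transitive. $\mathsf{SIE}_1$ is the intuitionistic set theory with axioms Extensionality, Pairing, Union, Binary Intersection, $V=\mathrm{Fin}$ (every set is in bijection with a von Neumann natural number), and Set Induction $\forall x[\forall y\in x\phi(y)\to\phi(x)]\to\forall x\phi(x)$ restricted to $\mathcal E_1$-formulas $\phi$, where $\mathcal E_1$ is the closure of the bounded ($\Delta_0$) formulas under $\land,\lor$, bounded quantifiers and $\exists$ (up to provable equivalence). -}

module Defs where

open import Data.Nat using (ℕ; zero; suc; _∸_)
open import Data.List using (List; []; _∷_; map)
open import Data.List.Membership.Propositional using (_∈_)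

-- Formulas (de Bruijn indices; the only terms are variables)

infixr 6 _∧'_
infixr 5 _∨'_
infixr 4 _⇒'_

data Formula : Set where
  mem  : ℕ → ℕ → Formula
  eq   : ℕ → ℕ → Formula
  ⊥'   : Formula
  _∧'_ : Formula → Formula → Formula
  _∨'_ : Formula → Formula → Formula
  _⇒'_ : Formula → Formula → Formula
  ∀'   : Formula → Formula
  ∃'   : Formula → Formula

lift : (ℕ → ℕ) → ℕ → ℕ
lift ρ zero    = zero
lift ρ (suc k) = suc (ρ k)

ren : (ℕ → ℕ) → Formula → Formula
ren ρ (mem x y) = mem (ρ x) (ρ y)
ren ρ (eq x y)  = eq (ρ x) (ρ y)
ren ρ ⊥'        = ⊥'
ren ρ (φ ∧' ψ)  = ren ρ φ ∧' ren ρ ψ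
ren ρ (φ ∨' ψ)  = ren ρ φ ∨' ren ρ ψ
ren ρ (φ ⇒' ψ)  = ren ρ φ ⇒' ren ρ ψ
ren ρ (∀' φ)    = ∀' (ren (lift ρ) φ)
ren ρ (∃' φ)    = ∃' (ren (lift ρ) φ)

subst0 : ℕ → Formula → Formula
subst0 t = ren σ
  where
  σ : ℕ → ℕ
  σ zero    = t
  σ (suc k) = k

weaken : Formula → Formula
weaken = ren suc

-- Formula classes Δ₀ and E₁.
-- Bounded quantifiers: ∀x∈y φ  is  ∀'(mem 0 (suc k) ⇒' φ),
--                      ∃x∈y φ  is  ∃'(mem 0 (suc k) ∧' φ)   (y = var k outside).

data Δ₀ : Formula → Set where
  mem  : ∀ x y → Δ₀ (mem x y)
  eq   : ∀ x y → Δ₀ (eq x y)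
  bot  : Δ₀ ⊥'
  and  : ∀ {φ ψ} → Δ₀ φ → Δ₀ ψ → Δ₀ (φ ∧' ψ)
  or   : ∀ {φ ψ} → Δ₀ φ → Δ₀ ψ → Δ₀ (φ ∨' ψ)
  imp  : ∀ {φ ψ} → Δ₀ φ → Δ₀ ψ → Δ₀ (φ ⇒' ψ)
  ball : ∀ {φ} k → Δ₀ φ → Δ₀ (∀' (mem 0 (suc k) ⇒' φ))
  bex  : ∀ {φ} k → Δ₀ φ → Δ₀ (∃' (mem 0 (suc k) ∧' φ))

data E₁ : Formula → Set where
  δ    : ∀ {φ} → Δ₀ φ → E₁ φ
  and  : ∀ {φ ψ} → E₁ φ → E₁ ψ → E₁ (φ ∧' ψ)
  or   : ∀ {φ ψ} → E₁ φ → E₁ ψ → E₁ (φ ∨' ψ)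
  ball : ∀ {φ} k → E₁ φ → E₁ (∀' (mem 0 (suc k) ⇒' φ))
  bex  : ∀ {φ} k → E₁ φ → E₁ (∃' (mem 0 (suc k) ∧' φ))
  ex   : ∀ {φ} → E₁ φ → E₁ (∃' φ)

-- Readable formula builders: variables are de Bruijn *levels*;
-- an FB is a formula waiting for the current binding depth.

FB : Set
FB = ℕ → Formula

infix  8 _∈̇_ _≐̇_
infixr 6 _∧̇_
infixr 5 _∨̇_
infixr 4 _⇒̇_ _⇔̇_

_∈̇_ : ℕ → ℕ → FB
(x ∈̇ y) d = mem (d ∸ suc x) (d ∸ suc y)

_≐̇_ : ℕ → ℕ → FB
(x ≐̇ y) d = eq (d ∸ suc x) (d ∸ suc y)

⊥̇ : FB
⊥̇ d = ⊥'

_∧̇_ _∨̇_ _⇒̇_ _⇔̇_ : FB → FB → FB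
(φ ∧̇ ψ) d = φ d ∧' ψ d
(φ ∨̇ ψ) d = φ d ∨' ψ d
(φ ⇒̇ ψ) d = φ d ⇒' ψ d
(φ ⇔̇ ψ) d = (φ d ⇒' ψ d) ∧' (ψ d ⇒' φ d)

¬̇ : FB → FB
¬̇ φ = φ ⇒̇ ⊥̇

-- quantifiers: the body receives the level of the bound variable
All Ex : (ℕ → FB) → FB
All f d = ∀' (f d (suc d))
Ex  f d = ∃' (f d (suc d))

AllIn ExIn : ℕ → (ℕ → FB) → FB
AllIn y f = All λ x → (x ∈̇ y) ⇒̇ f x
ExIn  y f = Ex  λ x → (x ∈̇ y) ∧̇ f x

sentence : FB → Formula
sentence φ = φ 0

Trans : ℕ → FB
Trans x = AllIn x λ y → AllIn y λ z → z ∈̇ x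

Ord : ℕ → FB
Ord x = Trans x ∧̇ AllIn x λ y → Trans y

ZeroOrSucc : ℕ → FB
ZeroOrSucc m = (AllIn m λ _ → ⊥̇)
             ∨̇ (ExIn m λ k → All λ w → (w ∈̇ m) ⇔̇ ((w ∈̇ k) ∨̇ (w ≐̇ k)))

Nat : ℕ → FB
Nat n = Ord n ∧̇ ZeroOrSucc n ∧̇ (AllIn n λ m → ZeroOrSucc m)

IsSingleton : ℕ → ℕ → FB
IsSingleton p a = All λ w → (w ∈̇ p) ⇔̇ (w ≐̇ a)

IsUPair : ℕ → ℕ → ℕ → FB
IsUPair p a b = All λ w → (w ∈̇ p) ⇔̇ ((w ≐̇ a) ∨̇ (w ≐̇ b))

IsOPair : ℕ → ℕ → ℕ → FB
IsOPair p a b = All λ z → (z ∈̇ p) ⇔̇ (IsSingleton z a ∨̇ IsUPair z a b)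

Bij : ℕ → ℕ → ℕ → FB
Bij f x n =
      (AllIn f λ p → ExIn x λ a → ExIn n λ b → IsOPair p a b)
   ∧̇ (AllIn x λ a → ExIn n λ b → ExIn f λ p → IsOPair p a b)
   ∧̇ (AllIn n λ b → ExIn x λ a → ExIn f λ p → IsOPair p a b)
   ∧̇ (AllIn f λ p → AllIn f λ q → All λ a → All λ b → All λ c →
         (IsOPair p a b ∧̇ IsOPair q a c) ⇒̇ (b ≐̇ c))
   ∧̇ (AllIn f λ p → AllIn f λ q → All λ a → All λ a' → All λ b →
         (IsOPair p a b ∧̇ IsOPair q a' b) ⇒̇ (a ≐̇ a'))

Extensionality Pairing Union BinaryIntersection VisFin : Formula
Extensionality = sentence (All λ x → All λ y →
  (All λ z → (z ∈̇ x) ⇔̇ (z ∈̇ y)) ⇒̇ (x ≐̇ y))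
Pairing = sentence (All λ x → All λ y → Ex λ p → IsUPair p x y)
Union = sentence (All λ x → Ex λ u → All λ z →
  (z ∈̇ u) ⇔̇ (ExIn x λ y → z ∈̇ y))
BinaryIntersection = sentence (All λ x → All λ y → Ex λ i → All λ z →
  (z ∈̇ i) ⇔̇ ((z ∈̇ x) ∧̇ (z ∈̇ y)))
VisFin = sentence (All λ x → Ex λ n → Ex λ f → Nat n ∧̇ Bij f x n)

-- Set induction instance for φ (variable 0 = induction variable,
-- higher variables = parameters, left free):
--   ∀x[∀y∈x φ(y) → φ(x)] → ∀x φ(x)
SetInd : Formula → Formula
SetInd φ = ∀' (∀' (mem 0 1 ⇒' ren ρ φ) ⇒' φ) ⇒' ∀' φ
  where
  ρ : ℕ → ℕ
  ρ zero    = zero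
  ρ (suc k) = suc (suc k)

data Axiom : Formula → Set where
  ext   : Axiom Extensionality
  pair  : Axiom Pairing
  union : Axiom Union
  inter : Axiom BinaryIntersection
  vfin  : Axiom VisFin
  ind   : ∀ {φ} → E₁ φ → Axiom (SetInd φ)

infix 2 _⊢_

data _⊢_ (Γ : List Formula) : Formula → Set where
  ax    : ∀ {φ} → Axiom φ → Γ ⊢ φ
  hyp   : ∀ {φ} → φ ∈ Γ → Γ ⊢ φ
  ⊥E    : ∀ {φ} → Γ ⊢ ⊥' → Γ ⊢ φ
  ∧I    : ∀ {φ ψ} → Γ ⊢ φ → Γ ⊢ ψ → Γ ⊢ φ ∧' ψ
  ∧E₁   : ∀ {φ ψ} → Γ ⊢ φ ∧' ψ → Γ ⊢ φ
  ∧E₂   : ∀ {φ ψ} → Γ ⊢ φ ∧' ψ → Γ ⊢ ψ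
  ∨I₁   : ∀ {φ ψ} → Γ ⊢ φ → Γ ⊢ φ ∨' ψ
  ∨I₂   : ∀ {φ ψ} → Γ ⊢ ψ → Γ ⊢ φ ∨' ψ
  ∨E    : ∀ {φ ψ χ} → Γ ⊢ φ ∨' ψ → (φ ∷ Γ) ⊢ χ → (ψ ∷ Γ) ⊢ χ → Γ ⊢ χ
  ⇒I    : ∀ {φ ψ} → (φ ∷ Γ) ⊢ ψ → Γ ⊢ φ ⇒' ψ
  ⇒E    : ∀ {φ ψ} → Γ ⊢ φ ⇒' ψ → Γ ⊢ φ → Γ ⊢ ψ
  ∀I    : ∀ {φ} → map weaken Γ ⊢ φ → Γ ⊢ ∀' φ
  ∀E    : ∀ {φ} t → Γ ⊢ ∀' φ → Γ ⊢ subst0 t φ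
  ∃I    : ∀ {φ} t → Γ ⊢ subst0 t φ → Γ ⊢ ∃' φ
  ∃E    : ∀ {φ χ} → Γ ⊢ ∃' φ → (φ ∷ map weaken Γ) ⊢ weaken χ → Γ ⊢ χ
  refl= : ∀ t → Γ ⊢ eq t t
  subst= : ∀ {φ} s t → Γ ⊢ eq s t → Γ ⊢ subst0 s φ → Γ ⊢ subst0 t φ

SIE₁⊢_ : Formula → Set
SIE₁⊢ φ = [] ⊢ φ

ExactlyOne : ℕ → ℕ → FB
ExactlyOne a b =
      ((a ∈̇ b) ∨̇ (a ≐̇ b) ∨̇ (b ∈̇ a))
   ∧̇ ¬̇ ((a ∈̇ b) ∧̇ (a ≐̇ b))
   ∧̇ ¬̇ ((a ≐̇ b) ∧̇ (b ∈̇ a))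
   ∧̇ ¬̇ ((a ∈̇ b) ∧̇ (b ∈̇ a))

OrdinalTrichotomy : Formula
OrdinalTrichotomy = sentence (All λ α → All λ β →
  (Ord α ∧̇ Ord β) ⇒̇ ExactlyOne α β)

module Submission where

open import Defs
open import Data.Nat using (ℕ; zero; suc; _∸_)
open import Data.List using ([]; _∷_)
open import Data.List.Relation.Unary.Any using (here; there)
open import Data.List.Relation.Binary.Subset.Propositional using (_⊆_)
open import Data.List.Relation.Binary.Subset.Propositional.Properties using (∷⁺ʳ; map⁺)
open import Data.Maybe using (Maybe; just; nothing; from-just; From-just)
import Data.Maybe as Maybe
open import Relation.Binary.PropositionalEquality using (refl)

-- Intuitionistically, trichotomy is proved by ∈-induction on a,
-- and inside it on β ∈ b ∪ {b}, from the following step: if a, b are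
-- transitive, every element of a is comparable with b and every element of b
-- with a, then a and b are comparable.  Indeed, either a ⊆ b or some c ∈ a has
-- c = b or b ∈ c, and symmetrically; extensionality and transitivity settle
-- the four combinations.  That dichotomy is where V = Fin stands in for
-- excluded middle: enumerate a by a natural number n and decide its elements
-- one at a time by induction along n.  All inductions are on Δ₀ formulas, so
-- ordered pairs enter through an equivalent Δ₀ form.  Exclusivity follows from
-- the irreflexivity of ∈, itself a Δ₀ instance of set induction.

⊢-weaken : ∀ {Γ Δ φ} → Γ ⊆ Δ → Γ ⊢ φ → Δ ⊢ φ
⊢-weaken s (ax a)           = ax a
⊢-weaken s (hyp x)          = hyp (s x)
⊢-weaken s (⊥E p)           = ⊥E (⊢-weaken s p)
⊢-weaken s (∧I p q)         = ∧I (⊢-weaken s p) (⊢-weaken s q)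
⊢-weaken s (∧E₁ p)          = ∧E₁ (⊢-weaken s p)
⊢-weaken s (∧E₂ p)          = ∧E₂ (⊢-weaken s p)
⊢-weaken s (∨I₁ p)          = ∨I₁ (⊢-weaken s p)
⊢-weaken s (∨I₂ p)          = ∨I₂ (⊢-weaken s p)
⊢-weaken s (∨E p q r)       = ∨E (⊢-weaken s p) (⊢-weaken (∷⁺ʳ _ s) q) (⊢-weaken (∷⁺ʳ _ s) r)
⊢-weaken s (⇒I p)           = ⇒I (⊢-weaken (∷⁺ʳ _ s) p)
⊢-weaken s (⇒E p q)         = ⇒E (⊢-weaken s p) (⊢-weaken s q)
⊢-weaken s (∀I p)           = ∀I (⊢-weaken (map⁺ weaken s) p)
⊢-weaken s (∀E t p)         = ∀E t (⊢-weaken s p)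
⊢-weaken s (∃I t p)         = ∃I t (⊢-weaken s p)
⊢-weaken s (∃E p q)         = ∃E (⊢-weaken s p) (⊢-weaken (∷⁺ʳ _ (map⁺ weaken s)) q)
⊢-weaken s (refl= t)        = refl= t
⊢-weaken s (subst= u t p q) = subst= u t (⊢-weaken s p) (⊢-weaken s q)

closed : ∀ {Γ φ} → SIE₁⊢ φ → Γ ⊢ φ
closed = ⊢-weaken λ ()

#0 : ∀ {Γ a} → a ∷ Γ ⊢ a
#0 = hyp (here refl)
#1 : ∀ {Γ a b} → b ∷ a ∷ Γ ⊢ a
#1 = hyp (there (here refl))
#2 : ∀ {Γ a b c} → c ∷ b ∷ a ∷ Γ ⊢ a
#2 = hyp (there (there (here refl)))
#3 : ∀ {Γ a b c d} → d ∷ c ∷ b ∷ a ∷ Γ ⊢ a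
#3 = hyp (there (there (there (here refl))))
#4 : ∀ {Γ a b c d e} → e ∷ d ∷ c ∷ b ∷ a ∷ Γ ⊢ a
#4 = hyp (there (there (there (there (here refl)))))
#5 : ∀ {Γ a b c d e f} → f ∷ e ∷ d ∷ c ∷ b ∷ a ∷ Γ ⊢ a
#5 = hyp (there (there (there (there (there (here refl))))))
#6 : ∀ {Γ a b c d e f g} → g ∷ f ∷ e ∷ d ∷ c ∷ b ∷ a ∷ Γ ⊢ a
#6 = hyp (there (there (there (there (there (there (here refl)))))))
#7 : ∀ {Γ a b c d e f g h} → h ∷ g ∷ f ∷ e ∷ d ∷ c ∷ b ∷ a ∷ Γ ⊢ a
#7 = hyp (there (there (there (there (there (there (there (here refl))))))))
#8 : ∀ {Γ a b c d e f g h i} → i ∷ h ∷ g ∷ f ∷ e ∷ d ∷ c ∷ b ∷ a ∷ Γ ⊢ a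
#8 = hyp (there (there (there (there (there (there (there (there (here refl)))))))))

have : ∀ {Γ φ ψ} → Γ ⊢ φ → φ ∷ Γ ⊢ ψ → Γ ⊢ ψ
have p q = ⇒E (⇒I q) p

-- Proof terms name variables by de Bruijn index, formula builders by level;
-- this is the index of level x at binding depth d.
index : ℕ → ℕ → ℕ
index d x = d ∸ suc x

≐-sym : ∀ {Γ s t} → Γ ⊢ eq s t → Γ ⊢ eq t s
≐-sym {s = s} {t} e = subst= {φ = eq 0 (suc s)} s t e (refl= s)

-- Leibniz's law for a motive F given as a formula builder whose hole is the
-- fresh level d, i.e. de Bruijn index 0 at depth suc d.
≐-subst : ∀ {Γ} d (F : ℕ → FB) {s t} →
          Γ ⊢ eq s t → Γ ⊢ subst0 s (F d (suc d)) → Γ ⊢ subst0 t (F d (suc d))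
≐-subst d F {s} {t} = subst= s t

∀∈E : ∀ {Γ k φ} t → Γ ⊢ ∀' (mem 0 (suc k) ⇒' φ) → Γ ⊢ mem t k → Γ ⊢ subst0 t φ
∀∈E t p q = ⇒E (∀E t p) q

Δ₀? : (φ : Formula) → Maybe (Δ₀ φ)
Δ₀? (mem x y)                    = just (mem x y)
Δ₀? (eq x y)                     = just (eq x y)
Δ₀? ⊥'                           = just bot
Δ₀? (φ ∧' ψ)                     = Maybe.zipWith and (Δ₀? φ) (Δ₀? ψ)
Δ₀? (φ ∨' ψ)                     = Maybe.zipWith or (Δ₀? φ) (Δ₀? ψ)
Δ₀? (φ ⇒' ψ)                     = Maybe.zipWith imp (Δ₀? φ) (Δ₀? ψ)
Δ₀? (∀' (mem zero (suc k) ⇒' φ)) = Maybe.map (ball k) (Δ₀? φ)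
Δ₀? (∀' _)                       = nothing
Δ₀? (∃' (mem zero (suc k) ∧' φ)) = Maybe.map (bex k) (Δ₀? φ)
Δ₀? (∃' _)                       = nothing

isΔ₀ : (φ : Formula) → From-just (Δ₀? φ)
isΔ₀ φ = from-just (Δ₀? φ)

∈-irrefl : SIE₁⊢ sentence (All λ x → ¬̇ (x ∈̇ x))
∈-irrefl = ⇒E (ax (ind (δ (isΔ₀ (mem 0 0 ⇒' ⊥')))))
             (∀I (⇒I (⇒I (⇒E (⇒E (∀E 0 #1) #0) #0))))

Ord-∈-closed : SIE₁⊢ sentence (All λ x → All λ y → Ord x ⇒̇ (y ∈̇ x) ⇒̇ Ord y)
Ord-∈-closed = ∀I (∀I (⇒I (⇒I (∧I (∀∈E (index 2 1) (∧E₂ #1) #0)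
  (∀I (⇒I (∀∈E (index 3 2) (∧E₂ #2) (∀∈E (index 3 2) (∀∈E (index 3 1) (∧E₁ #2) #1) #0))))))))

-- IsSingleton etc. quantify over all sets, which would take the induction
-- formulas below out of E₁.
IsSingleton₀ : ℕ → ℕ → FB
IsSingleton₀ z a = (a ∈̇ z) ∧̇ AllIn z (λ w → w ≐̇ a)

IsUPair₀ : ℕ → ℕ → ℕ → FB
IsUPair₀ z a b = (a ∈̇ z) ∧̇ (b ∈̇ z) ∧̇ AllIn z (λ w → (w ≐̇ a) ∨̇ (w ≐̇ b))

IsOPair₀ : ℕ → ℕ → ℕ → FB
IsOPair₀ p a b = (AllIn p λ z → IsSingleton₀ z a ∨̇ IsUPair₀ z a b)
               ∧̇ (ExIn p λ z → IsSingleton₀ z a)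
               ∧̇ (ExIn p λ z → IsUPair₀ z a b)

IsSingleton⇒IsSingleton₀ : SIE₁⊢ sentence (All λ z → All λ a → IsSingleton z a ⇒̇ IsSingleton₀ z a)
IsSingleton⇒IsSingleton₀ = ∀I (∀I (⇒I (∧I (⇒E (∧E₂ (∀E (index 2 1) #0)) (refl= (index 2 1)))
  (∀I (⇒I (⇒E (∧E₁ (∀E 0 #1)) #0))))))

IsSingleton₀⇒IsSingleton : SIE₁⊢ sentence (All λ z → All λ a → IsSingleton₀ z a ⇒̇ IsSingleton z a)
IsSingleton₀⇒IsSingleton = ∀I (∀I (⇒I (∀I (∧I (⇒I (∀∈E 0 (∧E₂ #1) #0))
  (⇒I (≐-subst 3 (λ h → h ∈̇ 0) (≐-sym #0) (∧E₁ #1)))))))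

IsUPair⇒IsUPair₀ : SIE₁⊢ sentence (All λ z → All λ a → All λ b → IsUPair z a b ⇒̇ IsUPair₀ z a b)
IsUPair⇒IsUPair₀ = ∀I (∀I (∀I (⇒I (∧I (⇒E (∧E₂ (∀E (index 3 1) #0)) (∨I₁ (refl= _)))
  (∧I (⇒E (∧E₂ (∀E (index 3 2) #0)) (∨I₂ (refl= _)))
      (∀I (⇒I (⇒E (∧E₁ (∀E 0 #1)) #0))))))))

IsUPair₀⇒IsUPair : SIE₁⊢ sentence (All λ z → All λ a → All λ b → IsUPair₀ z a b ⇒̇ IsUPair z a b)
IsUPair₀⇒IsUPair = ∀I (∀I (∀I (⇒I (∀I (∧I (⇒I (∀∈E 0 (∧E₂ (∧E₂ #1)) #0))
  (⇒I (∨E #0 (≐-subst 4 (λ h → h ∈̇ 0) (≐-sym #0) (∧E₁ #2))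
             (≐-subst 4 (λ h → h ∈̇ 0) (≐-sym #0) (∧E₁ (∧E₂ #2))))))))))

singleton-exists : SIE₁⊢ sentence (All λ a → Ex λ s → IsSingleton s a)
singleton-exists = ∀I (∃E (∀E 0 (∀E 0 (ax pair)))
  (∃I (index 2 1) (∀I (∧I (⇒I (∨E (⇒E (∧E₁ (∀E 0 #1)) #0) #0 #0))
                          (⇒I (⇒E (∧E₂ (∀E 0 #1)) (∨I₁ #0)))))))

IsSingleton-unique : SIE₁⊢ sentence (All λ z → All λ s → All λ a →
                       IsSingleton z a ⇒̇ IsSingleton s a ⇒̇ (z ≐̇ s))
IsSingleton-unique = ∀I (∀I (∀I (⇒I (⇒I (⇒E (∀E (index 3 1) (∀E (index 3 0) (ax ext)))
  (∀I (∧I (⇒I (⇒E (∧E₂ (∀E 0 #1)) (⇒E (∧E₁ (∀E 0 #2)) #0)))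
          (⇒I (⇒E (∧E₂ (∀E 0 #2)) (⇒E (∧E₁ (∀E 0 #1)) #0))))))))))

IsUPair-unique : SIE₁⊢ sentence (All λ z → All λ s → All λ a → All λ b →
                   IsUPair z a b ⇒̇ IsUPair s a b ⇒̇ (z ≐̇ s))
IsUPair-unique = ∀I (∀I (∀I (∀I (⇒I (⇒I (⇒E (∀E (index 4 1) (∀E (index 4 0) (ax ext)))
  (∀I (∧I (⇒I (⇒E (∧E₂ (∀E 0 #1)) (⇒E (∧E₁ (∀E 0 #2)) #0)))
          (⇒I (⇒E (∧E₂ (∀E 0 #2)) (⇒E (∧E₁ (∀E 0 #1)) #0)))))))))))

IsOPair⇒IsOPair₀ : SIE₁⊢ sentence (All λ p → All λ a → All λ b → IsOPair p a b ⇒̇ IsOPair₀ p a b)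
IsOPair⇒IsOPair₀ = ∀I (∀I (∀I (⇒I (∧I
  (∀I (⇒I (∨E (⇒E (∧E₁ (∀E 0 #1)) #0)
     (∨I₁ (⇒E (∀E (index 4 1) (∀E 0 (closed IsSingleton⇒IsSingleton₀))) #0))
     (∨I₂ (⇒E (∀E (index 4 2) (∀E (index 4 1) (∀E 0 (closed IsUPair⇒IsUPair₀)))) #0)))))
  (∧I
  (∃E (∀E (index 3 1) (closed singleton-exists))
     (∃I 0 (∧I (⇒E (∧E₂ (∀E 0 #1)) (∨I₁ #0))
               (⇒E (∀E (index 4 1) (∀E 0 (closed IsSingleton⇒IsSingleton₀))) #0))))
  (∃E (∀E (index 3 2) (∀E (index 3 1) (ax pair)))
     (∃I 0 (∧I (⇒E (∧E₂ (∀E 0 #1)) (∨I₂ #0))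
               (⇒E (∀E (index 4 2) (∀E (index 4 1) (∀E 0 (closed IsUPair⇒IsUPair₀)))) #0)))))))))

IsOPair₀⇒IsOPair : SIE₁⊢ sentence (All λ p → All λ a → All λ b → IsOPair₀ p a b ⇒̇ IsOPair p a b)
IsOPair₀⇒IsOPair = ∀I (∀I (∀I (⇒I (∀I (∧I
  (⇒I (∨E (∀∈E 0 (∧E₁ #1) #0)
     (∨I₁ (⇒E (∀E (index 4 1) (∀E 0 (closed IsSingleton₀⇒IsSingleton))) #0))
     (∨I₂ (⇒E (∀E (index 4 2) (∀E (index 4 1) (∀E 0 (closed IsUPair₀⇒IsUPair)))) #0))))
  (⇒I (∨E #0
     (∃E (∧E₁ (∧E₂ #2))
        (≐-subst 5 (λ h → h ∈̇ 0)
           (≐-sym (⇒E (⇒E (∀E 3 (∀E 0 (∀E 1 (closed IsSingleton-unique)))) #1)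
                      (⇒E (∀E 3 (∀E 0 (closed IsSingleton₀⇒IsSingleton))) (∧E₂ #0))))
           (∧E₁ #0)))
     (∃E (∧E₂ (∧E₂ #2))
        (≐-subst 5 (λ h → h ∈̇ 0)
           (≐-sym (⇒E (⇒E (∀E 2 (∀E 3 (∀E 0 (∀E 1 (closed IsUPair-unique))))) #1)
                      (⇒E (∀E 2 (∀E 3 (∀E 0 (closed IsUPair₀⇒IsUPair)))) (∧E₂ #0))))
           (∧E₁ #0))))))))))

Comparable : ℕ → ℕ → FB
Comparable a b = (a ∈̇ b) ∨̇ (a ≐̇ b) ∨̇ (b ∈̇ a)

AtLeast : ℕ → ℕ → FB
AtLeast a y = (a ≐̇ y) ∨̇ (y ∈̇ a)

SomeAtLeast : ℕ → ℕ → FB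
SomeAtLeast x y = ExIn x λ a → AtLeast a y

PreimageIn : ℕ → ℕ → ℕ → ℕ → FB
PreimageIn f x y k = AllIn f λ p → AllIn x λ a → IsOPair₀ p a k ⇒̇ (a ∈̇ y)

preimage-in-or-atLeast : SIE₁⊢ sentence (All λ x → All λ y → All λ n → All λ f →
  Bij f x n ⇒̇ (AllIn x λ a → Comparable a y) ⇒̇
  AllIn n λ k → PreimageIn f x y k ∨̇ SomeAtLeast x y)
preimage-in-or-atLeast = ∀I (∀I (∀I (∀I (⇒I (⇒I (∀I (⇒I
  (∃E (∀∈E 0 (∧E₁ (∧E₂ (∧E₂ #2))) #0) (∃E (∧E₂ #0)
  (∨E (∀∈E 1 #3 (∧E₁ #1))
    (∨I₁ (∀I (⇒I (∀I (⇒I (⇒I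
      (≐-subst 9 (λ h → h ∈̇ 1)
        (≐-sym (⇒E (∀E 4 (∀E 3 (∀E 0 (∀∈E 2 (∀∈E 1 (∧E₂ (∧E₂ (∧E₂ (∧E₂ #8)))) #2) (∧E₁ #4)))))
          (∧I (⇒E (∀E 4 (∀E 0 (∀E 1 (closed IsOPair₀⇒IsOPair)))) #0) (∧E₂ #4))))
        #3)))))))
    (∨I₂ (∃I 1 (∧I (∧E₁ #2) #0)))))))))))))

all-preimage-in-or-atLeast : SIE₁⊢ sentence (All λ x → All λ y → All λ n → All λ f →
  Nat n ⇒̇ (AllIn n λ k → PreimageIn f x y k ∨̇ SomeAtLeast x y) ⇒̇
  (AllIn n λ k → PreimageIn f x y k) ∨̇ SomeAtLeast x y)
all-preimage-in-or-atLeast = ∀I (∀I (∀I (∀I (⇒I (⇒I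
  (⇒E (∀E 1 (⇒E (ax (ind (δ (isΔ₀ (UpTo 4 5))))) step)) (∨I₂ (refl= 1))))))))
  where
  -- ∈-induction on m ∈ n ∪ {n}, each such m being ∅ or k ∪ {k}.
  UpTo : ℕ → FB
  UpTo m = ((m ∈̇ 2) ∨̇ (m ≐̇ 2)) ⇒̇ (AllIn m λ k → PreimageIn 3 0 1 k) ∨̇ SomeAtLeast 0 1
  step : (AllIn 2 λ k → PreimageIn 3 0 1 k ∨̇ SomeAtLeast 0 1) 4 ∷ Nat 2 4 ∷ [] ⊢
         ∀' (∀' (mem 0 1 ⇒' UpTo 5 6) ⇒' UpTo 4 5)
  step = ∀I (⇒I (⇒I
    (have (∨E #0 (∀∈E 0 (∧E₂ (∧E₂ #4)) #0)
                 (≐-subst 5 (λ h → ZeroOrSucc h) (≐-sym #0) (∧E₁ (∧E₂ #4))))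
    (∨E #0
      (∨I₁ (∀I (⇒I (⊥E (∀∈E 0 #1 #0)))))
      (∃E #0
        (have (∨E #3 (∀∈E 0 (∀∈E 1 (∧E₁ (∧E₁ #7)) #0) (∧E₁ #1))
                     (≐-subst 6 (λ h → 5 ∈̇ h) #0 (∧E₁ #1)))
        (have (⇒E (⇒E (∀E 0 #5) (∧E₁ #1)) (∨I₁ #0))
        (have (∀∈E 0 #7 #1)
        (∨E #1
          (∨E #1
            (∨I₁ (∀I (⇒I (∨E (⇒E (∧E₁ (∀E 0 (∧E₂ #6))) #0)
                             (∀∈E 0 #3 #0)
                             (≐-subst 7 (λ h → PreimageIn 3 0 1 h) (≐-sym #0) #2)))))
            (∨I₂ #0))
          (∨I₂ #0))))))))))

all-preimage-in⇒⊆ : SIE₁⊢ sentence (All λ x → All λ y → All λ n → All λ f →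
  Bij f x n ⇒̇ (AllIn n λ k → PreimageIn f x y k) ⇒̇ AllIn x λ a → a ∈̇ y)
all-preimage-in⇒⊆ = ∀I (∀I (∀I (∀I (⇒I (⇒I (∀I (⇒I
  (∃E (∀∈E 0 (∧E₁ (∧E₂ #2)) #0) (∃E (∧E₂ #0)
    (⇒E (∀∈E 2 (∀∈E 0 (∀∈E 1 #3 (∧E₁ #1)) (∧E₁ #0)) #2)
        (⇒E (∀E 1 (∀E 2 (∀E 0 (closed IsOPair⇒IsOPair₀)))) (∧E₂ #0))))))))))))

⊆-or-atLeast : SIE₁⊢ sentence (All λ x → All λ y → (AllIn x λ a → Comparable a y) ⇒̇
                 (AllIn x λ a → a ∈̇ y) ∨̇ SomeAtLeast x y)
⊆-or-atLeast = ∀I (∀I (⇒I (∃E (∀E 1 (ax vfin)) (∃E #0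
  (∨E (⇒E (⇒E (∀E 0 (∀E 1 (∀E 2 (∀E 3 (closed all-preimage-in-or-atLeast))))) (∧E₁ #0))
          (⇒E (⇒E (∀E 0 (∀E 1 (∀E 2 (∀E 3 (closed preimage-in-or-atLeast))))) (∧E₂ #0)) #2))
      (∨I₁ (⇒E (⇒E (∀E 0 (∀E 1 (∀E 2 (∀E 3 (closed all-preimage-in⇒⊆))))) (∧E₂ #1)) #0))
      (∨I₂ #0))))))

Comparable-sym : SIE₁⊢ sentence (All λ a → All λ b → Comparable a b ⇒̇ Comparable b a)
Comparable-sym = ∀I (∀I (⇒I (∨E #0 (∨I₂ (∨I₂ #0)) (∨E #0 (∨I₂ (∨I₁ (≐-sym #0))) (∨I₁ #0)))))

comparable-step : SIE₁⊢ sentence (All λ a → All λ b → Trans a ⇒̇ Trans b ⇒̇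
  (AllIn a λ c → Comparable c b) ⇒̇ (AllIn b λ d → Comparable d a) ⇒̇ Comparable a b)
comparable-step = ∀I (∀I (⇒I (⇒I (⇒I (⇒I
  (∨E (⇒E (∀E 0 (∀E 1 (closed ⊆-or-atLeast))) #1)
    (∨E (⇒E (∀E 1 (∀E 0 (closed ⊆-or-atLeast))) #1)
      (∨I₂ (∨I₁ (⇒E (∀E 0 (∀E 1 (ax ext))) (∀I (∧I (⇒I (∀∈E 0 #2 #0)) (⇒I (∀∈E 0 #1 #0)))))))
      (∃E #0 (∨I₁ (∨E (∧E₂ #0) (≐-subst 3 (λ h → h ∈̇ 1) #0 (∧E₁ #1))
                               (∀∈E 2 (∀∈E 0 #6 (∧E₁ #1)) #0)))))
    (∃E #0 (∨I₂ (∨I₂ (∨E (∧E₂ #0) (≐-subst 3 (λ h → h ∈̇ 0) #0 (∧E₁ #1))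
                                 (∀∈E 1 (∀∈E 0 #6 (∧E₁ #1)) #0)))))))))))

comparable-with-elements : SIE₁⊢ sentence (All λ b → Ord b ⇒̇ All λ a → Ord a ⇒̇
  (AllIn b λ β → Comparable a β) ∧̇ Comparable a b)
comparable-with-elements = ∀I (⇒I (⇒E (ax (ind (δ (isΔ₀ (P 1 2))))) outer))
  where
  -- The outer hypothesis covers the elements of b too, as the inner step
  -- compares the elements of a with every β ∈ b ∪ {b}.
  P : ℕ → FB
  P a = Ord a ⇒̇ (AllIn 0 λ β → Comparable a β) ∧̇ Comparable a 0
  Q : ℕ → FB
  Q β = ((β ∈̇ 0) ∨̇ (β ≐̇ 0)) ⇒̇ Comparable 1 β
  inner : Ord 1 2 ∷ ∀' (mem 0 1 ⇒' P 2 3) ∷ Ord 0 2 ∷ [] ⊢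
          ∀' (∀' (mem 0 1 ⇒' Q 3 4) ⇒' Q 2 3)
  inner = ∀I (⇒I (⇒I
    (have (∨E #0 (⇒E (⇒E (∀E 0 (∀E 2 (closed Ord-∈-closed))) #5) #0)
                 (≐-subst 3 (λ h → Ord h) (≐-sym #0) #5))
    (have (∀I (⇒I (have (⇒E (⇒E (∀E 0 #5) #0) (⇒E (⇒E (∀E 0 (∀E 2 (closed Ord-∈-closed))) #4) #0))
                  (∨E #3 (∀∈E 1 (∧E₁ #1) #0)
                         (≐-subst 4 (λ h → Comparable 3 h) (≐-sym #0) (∧E₂ #1))))))
    (have (∀I (⇒I (have (∨E #3 (∀∈E 0 (∀∈E 1 (∧E₁ #8) #0) #1)
                               (≐-subst 4 (λ h → 3 ∈̇ h) #0 #1))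
                  (⇒E (∀E 0 (∀E 2 (closed Comparable-sym))) (⇒E (⇒E (∀E 0 #5) #1) (∨I₁ #0))))))
    (⇒E (⇒E (⇒E (⇒E (∀E 0 (∀E 1 (closed comparable-step))) (∧E₁ #5)) (∧E₁ #2)) #1) #0))))))
  outer : Ord 0 1 ∷ [] ⊢ ∀' (∀' (mem 0 1 ⇒' P 2 3) ⇒' P 1 2)
  outer = ∀I (⇒I (⇒I (have (⇒E (ax (ind (δ (isΔ₀ (Q 2 3))))) inner)
    (∧I (∀I (⇒I (⇒E (∀E 0 #1) (∨I₁ #0)))) (⇒E (∀E 1 #0) (∨I₂ (refl= 1)))))))

ordinals-comparable : SIE₁⊢ sentence (All λ a → All λ b → (Ord a ∧̇ Ord b) ⇒̇ Comparable a b)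
ordinals-comparable = ∀I (∀I (⇒I
  (∧E₂ (⇒E (∀E 1 (⇒E (∀E 0 (closed comparable-with-elements)) (∧E₂ #0))) (∧E₁ #0)))))

∈⇒≢ : SIE₁⊢ sentence (All λ x → All λ y → (x ∈̇ y) ⇒̇ ¬̇ (x ≐̇ y))
∈⇒≢ = ∀I (∀I (⇒I (⇒I (⇒E (∀E 1 (closed ∈-irrefl)) (≐-subst 2 (λ h → 0 ∈̇ h) (≐-sym #0) #1)))))

Trans-∈-asym : SIE₁⊢ sentence (All λ x → All λ y → Trans y ⇒̇ (x ∈̇ y) ⇒̇ ¬̇ (y ∈̇ x))
Trans-∈-asym = ∀I (∀I (⇒I (⇒I (⇒I (⇒E (∀E 0 (closed ∈-irrefl)) (∀∈E 0 (∀∈E 1 #2 #1) #0))))))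

mainTheorem14 : SIE₁⊢ OrdinalTrichotomy
mainTheorem14 = ∀I (∀I (⇒I (∧I
  (⇒E (∀E 0 (∀E 1 (closed ordinals-comparable))) #0)
  (∧I (⇒I (⇒E (⇒E (∀E 0 (∀E 1 (closed ∈⇒≢))) (∧E₁ #0)) (∧E₂ #0)))
  (∧I (⇒I (⇒E (⇒E (∀E 1 (∀E 0 (closed ∈⇒≢))) (∧E₂ #0)) (≐-sym (∧E₁ #0))))
      (⇒I (⇒E (⇒E (⇒E (∀E 0 (∀E 1 (closed Trans-∈-asym))) (∧E₁ (∧E₂ #1))) (∧E₁ #0)) (∧E₂ #0))))))))
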